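{- If the signature of a cubic girth-regular graph is $(0,b,c)$, then $b=c=1$.
   Context: Graphs are finite and simple; cubic means $3$-regular. For a graph of finite girth $g$, a girth cycle is a cycle of length $g$, and $\epsilon(e)$ is the number of girth cycles containing the edge $e$. The signature of a vertex $v$ with incident edges $e_1,\ldots,e_k$ ordered so that $\epsilon(e_1)\le\cdots\le\epsilon(e_k)$ is $(\epsilon(e_1),\ldots,\epsilon(e_k))$; a graph is girth-regular if all vertices have the same signature (the signature of the graph). -}

module Defs where

open import Data.Nat using (ℕ; zero; suc; _∸_; _<_; _≤ᵇ_)
open import Data.Nat.Properties using (≤-decTotalOrder)
open import Data.Bool using (Bool; true; false; _∧_; not; T)
open import Data.Bool.Properties using (T?)
open import Data.Fin using (Fin; _≟_)
open import Data.List using (List; []; _∷_; [_]; _++_; length; map; filter; concatMap)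
open import Data.Bool.ListAction using (any)
open import Data.List.Sort.Base using (SortingAlgorithm)
open import Data.List.Sort.MergeSort ≤-decTotalOrder using (mergeSort)
open import Data.Product using (Σ; _×_)
open import Relation.Nullary using (¬_)
open import Relation.Nullary.Decidable using (⌊_⌋)
open import Relation.Binary.PropositionalEquality using (_≡_)

record Graph (n : ℕ) : Set where
  field
    adj    : Fin n → Fin n → Bool
    sym    : ∀ u v → adj u v ≡ adj v u
    irrefl : ∀ v → adj v v ≡ false
open Graph public

module _ {n : ℕ} (G : Graph n) where

  allVertices : List (Fin n)
  allVertices = Data.List.allFin n

  neighbours : Fin n → List (Fin n)
  neighbours v = filter (λ u → T? (adj G v u)) allVertices

  degree : Fin n → ℕ
  degree v = length (neighbours v)

  Cubic : Set
  Cubic = ∀ v → degree v ≡ 3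

  linked : List (Fin n) → Bool
  linked (a ∷ b ∷ r) = adj G a b ∧ linked (b ∷ r)
  linked _ = true

  distinct : List (Fin n) → Bool
  distinct [] = true
  distinct (x ∷ xs) = not (any (λ y → ⌊ x ≟ y ⌋) xs) ∧ distinct xs

  closed : List (Fin n) → Bool
  closed [] = false
  closed (x ∷ xs) = linked (x ∷ xs ++ [ x ])

  isCycle : List (Fin n) → Bool
  isCycle vs = (3 ≤ᵇ length vs) ∧ distinct vs ∧ closed vs

  HasCycleOfLength : ℕ → Set
  HasCycleOfLength k = Σ (List (Fin n)) λ vs → length vs ≡ k × T (isCycle vs)

  Girth : ℕ → Set
  Girth g = HasCycleOfLength g × (∀ k → k < g → ¬ HasCycleOfLength k)

  -- all walks with (k+1) vertices starting at u
  walks : ℕ → Fin n → List (List (Fin n))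
  walks zero u = [ u ∷ [] ]
  walks (suc k) u = concatMap (λ w → map (u ∷_) (walks k w)) (neighbours u)

  startsWithEdge : Fin n → Fin n → List (Fin n) → Bool
  startsWithEdge u v (a ∷ b ∷ _) = ⌊ a ≟ u ⌋ ∧ ⌊ b ≟ v ⌋
  startsWithEdge u v _ = false

  -- ε(uv) for girth g: number of girth cycles containing the edge uv.
  -- Each such cycle corresponds to exactly one vertex sequence
  -- u = v₀, v = v₁, v₂, …, v_{g-1} traversing it (orientation fixed by u → v).
  ε : ℕ → Fin n → Fin n → ℕ
  ε g u v = length (filter (λ w → T? (isCycle w ∧ startsWithEdge u v w)) (walks (g ∸ 1) u))

  sortℕ : List ℕ → List ℕ
  sortℕ = SortingAlgorithm.sort mergeSort

  signature : ℕ → Fin n → List ℕ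
  signature g v = sortℕ (map (ε g v) (neighbours v))

  GirthRegular : ℕ → Set
  GirthRegular g = ∀ u v → signature g u ≡ signature g v

module Submission where

-- Call an edge x → y *active* when ε(xy) > 0, i.e. some girth cycle passes
-- along it.  A vertex x of degree 3 with an ε = 0 edge has at most two
-- active neighbours.  Along a girth cycle … a x y … both edges at x are
-- active and a ≠ y, so when every vertex has at most two active neighbours,
-- the vertex following x is forced: a girth cycle is determined by its first
-- edge, i.e. ε ≤ 1 everywhere.  At the middle vertex x₁ of a girth cycle
-- x₀ x₁ x₂ … the two cycle edges are then active with ε = 1, so the value 1
-- occurs twice in the signature (0, b, c), forcing b = c = 1.

open import Data.Nat using (ℕ; zero; suc; _≤_; _<_; z≤n; s≤s; _∸_)
  renaming (_≟_ to _≟ℕ_)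
open import Data.Nat.Properties using (module ≤-Reasoning; ≤-antisym; <-irrefl; suc-injective; ≤ᵇ⇒≤; ≤⇒≤ᵇ; ≤-decTotalOrder)
open import Data.Bool using (T; true; false; not; _∧_)
open import Data.Bool.ListAction using (any)
open import Data.Bool.Properties using (T-∧; T?)
open import Data.Unit using (⊤; tt)
open import Data.Empty using (⊥; ⊥-elim)
open import Data.Fin using (Fin; _≟_)
open import Data.List using (List; []; _∷_; [_]; _++_; _∷ʳ_; length; map; filter; concatMap; reverse)
open import Data.List.Properties using (++-assoc; ++-identityʳ; reverse-++; unfold-reverse; length-reverse; length-++-comm; ∷-injectiveˡ; ∷-injectiveʳ)
open import Data.List.Relation.Unary.All using (All; []; _∷_)
import Data.List.Relation.Unary.All as All
open import Data.List.Relation.Unary.Any using (here; there)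
open import Data.List.Relation.Unary.AllPairs using ([]; _∷_)
open import Data.List.Relation.Unary.Linked using (Linked; []; [-]; _∷_)
open import Data.List.Relation.Unary.Unique.Propositional using (Unique)
open import Data.List.Relation.Unary.Unique.Propositional.Properties using (filter⁺; allFin⁺; ++⁺; map⁺)
open import Data.List.Membership.Propositional using (_∈_; find; lose)
open import Data.List.Membership.Propositional.Properties using (∈-filter⁺; ∈-filter⁻; ∈-allFin; ∈-map⁺; ∈-map⁻; ∈-concatMap⁺; ∈-concatMap⁻)
open import Data.List.Relation.Binary.Permutation.Propositional using (_↭_; prep; ↭-sym; ↭⇒↭ₛ)
open import Data.List.Relation.Binary.Permutation.Propositional.Properties using (↭-reverse; ∈-resp-↭; filter-↭; ↭-length; ++-comm)
import Data.List.Relation.Binary.Permutation.Setoid.Properties as SetoidPermutation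
open import Data.List.Sort.Base using (SortingAlgorithm)
open import Data.List.Sort.MergeSort ≤-decTotalOrder using (mergeSort)
open import Data.Product using (∃; _×_; _,_; proj₁; proj₂)
open import Function using (_∘_)
open import Function.Bundles using (Equivalence)
open import Relation.Binary.Definitions using (Symmetric)
open import Relation.Nullary using (¬_; Dec; yes; no; does)
open import Relation.Nullary.Decidable using (⌊_⌋; fromWitness; toWitness)
open import Relation.Unary using (Decidable)
open import Relation.Binary.PropositionalEquality using (_≡_; _≢_; refl; sym; trans; cong; subst; setoid; module ≡-Reasoning)

open import Defs hiding (sym)

open Equivalence using (to; from)

module _ {A : Set} where

  remove : ∀ {x : A} {xs} → x ∈ xs →
           ∃ λ xs′ → length xs ≡ suc (length xs′) × (∀ {y} → y ∈ xs → y ≢ x → y ∈ xs′)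
  remove {x} {_ ∷ xs} (here refl) = xs , refl , keep
    where
    keep : ∀ {y} → y ∈ x ∷ xs → y ≢ x → y ∈ xs
    keep (here refl) y≢x = ⊥-elim (y≢x refl)
    keep (there y∈xs) _  = y∈xs
  remove {x} {z ∷ xs} (there x∈xs) with xs′ , len , keep ← remove x∈xs =
    z ∷ xs′ , cong suc len , keep′
    where
    keep′ : ∀ {y} → y ∈ z ∷ xs → y ≢ x → y ∈ z ∷ xs′
    keep′ (here refl)  _   = here refl
    keep′ (there y∈xs) y≢x = there (keep y∈xs y≢x)

  unique⊆⇒length≤ : ∀ {ys xs : List A} → Unique ys → All (_∈ xs) ys → length ys ≤ length xs
  unique⊆⇒length≤ [] [] = z≤n
  unique⊆⇒length≤ (y∉ys ∷ uniq) (y∈xs ∷ ys⊆xs) with xs′ , len , keep ← remove y∈xs =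
    subst (_ ≤_) (sym len)
      (s≤s (unique⊆⇒length≤ uniq (All.zipWith (λ (m , y≢z) → keep m (y≢z ∘ sym)) (ys⊆xs , y∉ys))))

  allEqual⇒length≤1 : ∀ {xs : List A} → Unique xs →
                      (∀ {w w′} → w ∈ xs → w′ ∈ xs → w ≡ w′) → length xs ≤ 1
  allEqual⇒length≤1 {[]}    _    _    = z≤n
  allEqual⇒length≤1 {w ∷ _} uniq same =
    unique⊆⇒length≤ {xs = [ w ]} uniq (All.tabulate (λ m → here (same m (here refl))))

  ∈⇒0<length : ∀ {x : A} {xs} → x ∈ xs → 0 < length xs
  ∈⇒0<length (here _)  = s≤s z≤n
  ∈⇒0<length (there _) = s≤s z≤n

  0<length⇒∈ : ∀ {xs : List A} → 0 < length xs → ∃ λ x → x ∈ xs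
  0<length⇒∈ {x ∷ _} _ = x , here refl

  Unique-resp-↭ : ∀ {xs ys : List A} → xs ↭ ys → Unique xs → Unique ys
  Unique-resp-↭ p = SetoidPermutation.Unique-resp-↭ (setoid A) (↭⇒↭ₛ p)

  length-filter-map : ∀ {B : Set} {P : B → Set} (P? : Decidable P) (f : A → B) xs →
                      length (filter P? (map f xs)) ≡ length (filter (P? ∘ f) xs)
  length-filter-map P? f [] = refl
  length-filter-map P? f (x ∷ xs) with does (P? (f x))
  ... | true  = cong suc (length-filter-map P? f xs)
  ... | false = length-filter-map P? f xs

reverse-around : ∀ {A : Set} (s : List A) y x t → reverse (s ++ y ∷ x ∷ t) ≡ reverse t ++ x ∷ y ∷ reverse s
reverse-around s y x t = begin
  reverse (s ++ y ∷ x ∷ t)              ≡⟨ reverse-++ s (y ∷ x ∷ t) ⟩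
  reverse (y ∷ x ∷ t) ++ reverse s      ≡⟨ cong (_++ reverse s) (reverse-++ (y ∷ x ∷ []) t) ⟩
  (reverse t ++ x ∷ y ∷ []) ++ reverse s ≡⟨ ++-assoc (reverse t) (x ∷ y ∷ []) (reverse s) ⟩
  reverse t ++ x ∷ y ∷ reverse s        ∎
  where open ≡-Reasoning

module _ {A : Set} {R : A → A → Set} where

  Linked-prefix : ∀ xs {ys} → Linked R (xs ++ ys) → Linked R xs
  Linked-prefix []           _       = []
  Linked-prefix (x ∷ [])     _       = [-]
  Linked-prefix (x ∷ y ∷ xs) (r ∷ l) = r ∷ Linked-prefix (y ∷ xs) l

  Linked-∷ʳ : ∀ xs {y z} → Linked R (xs ∷ʳ y) → R y z → Linked R (xs ∷ʳ y ∷ʳ z)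
  Linked-∷ʳ []           _       r = r ∷ [-]
  Linked-∷ʳ (x ∷ [])     (r′ ∷ _) r = r′ ∷ r ∷ [-]
  Linked-∷ʳ (x ∷ y ∷ xs) (r′ ∷ l) r = r′ ∷ Linked-∷ʳ (y ∷ xs) l r

  Linked-reverse : Symmetric R → ∀ {xs} → Linked R xs → Linked R (reverse xs)
  Linked-reverse R-sym []  = []
  Linked-reverse R-sym [-] = [-]
  Linked-reverse R-sym {x ∷ y ∷ xs} (r ∷ l) =
    subst (Linked R) (sym reverse-xyxs)
      (Linked-∷ʳ (reverse xs) (subst (Linked R) (unfold-reverse y xs) (Linked-reverse R-sym l)) (R-sym r))
    where
    reverse-xyxs : reverse (x ∷ y ∷ xs) ≡ reverse xs ∷ʳ y ∷ʳ x
    reverse-xyxs = trans (unfold-reverse x (y ∷ xs)) (cong (_∷ʳ x) (unfold-reverse y xs))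

length-girth : ∀ g → 3 ≤ suc (g ∸ 1) → suc (g ∸ 1) ≡ g
length-girth zero    (s≤s ())
length-girth (suc g) _ = refl

ones : List ℕ → ℕ
ones xs = length (filter (_≟ℕ 1) xs)

two-ones⇒ : ∀ b c → 2 ≤ ones (0 ∷ b ∷ c ∷ []) → b ≡ 1 × c ≡ 1
two-ones⇒ 1             1             _          = refl , refl
two-ones⇒ 0             0             ()
two-ones⇒ 0             1             (s≤s ())
two-ones⇒ 0             (suc (suc _)) ()
two-ones⇒ 1             0             (s≤s ())
two-ones⇒ 1             (suc (suc _)) (s≤s ())
two-ones⇒ (suc (suc _)) 0             ()
two-ones⇒ (suc (suc _)) 1             (s≤s ())
two-ones⇒ (suc (suc _)) (suc (suc _)) ()

module _ {n : ℕ} (G : Graph n) where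

  private
    V : Set
    V = Fin n

  Adj : V → V → Set
  Adj u v = T (adj G u v)

  Adj-sym : Symmetric Adj
  Adj-sym {u} {v} = subst T (Graph.sym G u v)

  Closed : List V → Set
  Closed []       = ⊥
  Closed (x ∷ xs) = Linked Adj (x ∷ xs ++ [ x ])

  record IsCycle (vs : List V) : Set where
    field
      atLeast3   : 3 ≤ length vs
      noRepeat   : Unique vs
      closedWalk : Closed vs
  open IsCycle

  linked⇒Linked : ∀ xs → T (linked G xs) → Linked Adj xs
  linked⇒Linked []           _ = []
  linked⇒Linked (x ∷ [])     _ = [-]
  linked⇒Linked (x ∷ y ∷ xs) h = proj₁ (to T-∧ h) ∷ linked⇒Linked (y ∷ xs) (proj₂ (to T-∧ h))

  Linked⇒linked : ∀ {xs} → Linked Adj xs → T (linked G xs)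
  Linked⇒linked []      = tt
  Linked⇒linked [-]     = tt
  Linked⇒linked (a ∷ l) = from T-∧ (a , Linked⇒linked l)

  distinct⇒Unique : ∀ xs → T (distinct G xs) → Unique xs
  distinct⇒Unique []       _ = []
  distinct⇒Unique (x ∷ xs) h with x∉xs , d ← to T-∧ h = new x xs x∉xs ∷ distinct⇒Unique xs d
    where
    new : ∀ x ys → T (not (any (λ y → ⌊ x ≟ y ⌋) ys)) → All (x ≢_) ys
    new x []       _ = []
    new x (y ∷ ys) h with x ≟ y
    ... | no x≢y = x≢y ∷ new x ys h

  Unique⇒distinct : ∀ {xs} → Unique xs → T (distinct G xs)
  Unique⇒distinct []             = tt
  Unique⇒distinct (x∉xs ∷ uniq) = from T-∧ (new x∉xs , Unique⇒distinct uniq)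
    where
    new : ∀ {x ys} → All (x ≢_) ys → T (not (any (λ y → ⌊ x ≟ y ⌋) ys))
    new []                   = tt
    new {x} {y ∷ _} (x≢y ∷ ys) with x ≟ y
    ... | yes x≡y = x≢y x≡y
    ... | no _    = new ys

  isCycle⇒IsCycle : ∀ vs → T (isCycle G vs) → IsCycle vs
  isCycle⇒IsCycle []       ()
  isCycle⇒IsCycle (x ∷ xs) h with long , rest ← to T-∧ h with d , c ← to T-∧ rest =
    record { atLeast3 = ≤ᵇ⇒≤ 3 _ long ; noRepeat = distinct⇒Unique _ d ; closedWalk = linked⇒Linked _ c }

  IsCycle⇒isCycle : ∀ {vs} → IsCycle vs → T (isCycle G vs)
  IsCycle⇒isCycle {x ∷ _} cyc =
    from T-∧ (≤⇒≤ᵇ (atLeast3 cyc) , from T-∧ (Unique⇒distinct (noRepeat cyc) , Linked⇒linked (closedWalk cyc)))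

  Closed-rotate₁ : ∀ a xs → Closed (a ∷ xs) → Closed (xs ++ [ a ])
  Closed-rotate₁ a []       c       = c
  Closed-rotate₁ a (b ∷ xs) (r ∷ l) = Linked-∷ʳ (b ∷ xs) l r

  Closed-rotate : ∀ s r → Closed (s ++ r) → Closed (r ++ s)
  Closed-rotate []      r c = subst Closed (sym (++-identityʳ r)) c
  Closed-rotate (a ∷ s) r c =
    subst Closed (++-assoc r [ a ] s)
      (Closed-rotate s (r ++ [ a ]) (subst Closed (++-assoc s r [ a ]) (Closed-rotate₁ a (s ++ r) c)))

  Closed-reverse : ∀ a xs → Closed (a ∷ xs) → Closed (a ∷ reverse xs)
  Closed-reverse a xs c = subst (Linked Adj) reversed (Linked-reverse Adj-sym c)
    where
    reversed : reverse (a ∷ xs ++ [ a ]) ≡ a ∷ reverse xs ++ [ a ]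
    reversed = trans (unfold-reverse a (xs ++ [ a ])) (cong (_∷ʳ a) (reverse-++ xs [ a ]))

  IsCycle-rotate : ∀ s r → IsCycle (s ++ r) → IsCycle (r ++ s)
  IsCycle-rotate s r cyc = record
    { atLeast3   = subst (3 ≤_) (length-++-comm s r) (atLeast3 cyc)
    ; noRepeat   = Unique-resp-↭ (++-comm s r) (noRepeat cyc)
    ; closedWalk = Closed-rotate s r (closedWalk cyc)
    }

  IsCycle-reverse : ∀ {vs} → IsCycle vs → IsCycle (reverse vs)
  IsCycle-reverse {a ∷ xs} cyc =
    subst IsCycle (sym (unfold-reverse a xs)) (IsCycle-rotate [ a ] (reverse xs) backwards)
    where
    backwards : IsCycle (a ∷ reverse xs)
    backwards = record
      { atLeast3   = subst (λ k → 3 ≤ suc k) (sym (length-reverse xs)) (atLeast3 cyc)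
      ; noRepeat   = Unique-resp-↭ (prep a (↭-sym (↭-reverse xs))) (noRepeat cyc)
      ; closedWalk = Closed-reverse a xs (closedWalk cyc)
      }

  neighbours-unique : ∀ u → Unique (neighbours G u)
  neighbours-unique u = filter⁺ (λ w → T? (adj G u w)) (allFin⁺ n)

  Adj⇒neighbour : ∀ {u v} → Adj u v → v ∈ neighbours G u
  Adj⇒neighbour {u} {v} = ∈-filter⁺ (λ w → T? (adj G u w)) (∈-allFin v)

  walk-listed : ∀ {u} xs → Linked Adj (u ∷ xs) → (u ∷ xs) ∈ walks G (length xs) u
  walk-listed []       _       = here refl
  walk-listed {u} (v ∷ xs) (a ∷ l) =
    ∈-concatMap⁺ (λ w → map (u ∷_) (walks G (length xs) w))
      (lose (Adj⇒neighbour a) (∈-map⁺ (u ∷_) (walk-listed xs l)))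

  walk-shape : ∀ k {u w} → w ∈ walks G k u → ∃ λ ws → w ≡ u ∷ ws × length ws ≡ k
  walk-shape zero (here refl) = [] , refl , refl
  walk-shape (suc k) {u} w∈
    with v , _ , w∈v ← find (∈-concatMap⁻ (λ v → map (u ∷_) (walks G k v)) {xs = neighbours G u} w∈)
    with w′ , w′∈ , refl ← ∈-map⁻ (u ∷_) w∈v
    with ws , refl , len ← walk-shape k w′∈ = v ∷ ws , refl , cong suc len

  walks-unique : ∀ k u → Unique (walks G k u)
  walks-unique zero    u = [] ∷ []
  walks-unique (suc k) u = blocks (neighbours G u) (neighbours-unique u)
    where
    extend : V → List (List V)
    extend v = map (u ∷_) (walks G k v)

    second : ∀ {v w} → w ∈ extend v → ∃ λ ws → w ≡ u ∷ v ∷ ws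
    second w∈
      with w′ , w′∈ , refl ← ∈-map⁻ (u ∷_) w∈
      with ws , refl , _ ← walk-shape k w′∈ = ws , refl

    blocks : ∀ vs → Unique vs → Unique (concatMap extend vs)
    blocks []       _             = []
    blocks (v ∷ vs) (v∉vs ∷ uniq) = ++⁺ (map⁺ ∷-injectiveʳ (walks-unique k v)) (blocks vs uniq) disjoint
      where
      disjoint : ∀ {w} → w ∈ extend v × w ∈ concatMap extend vs → ⊥
      disjoint (w∈v , w∈vs) with v′ , v′∈vs , w∈v′ ← find (∈-concatMap⁻ extend {xs = vs} w∈vs)
        with _ , refl ← second w∈v with _ , same ← second w∈v′ =
        All.lookup v∉vs v′∈vs (∷-injectiveˡ (∷-injectiveʳ same))

  startsWithEdge-here : ∀ {u v r} → T (startsWithEdge G u v (u ∷ v ∷ r))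
  startsWithEdge-here {u} {v} = from T-∧ (fromWitness {a? = u ≟ u} refl , fromWitness {a? = v ≟ v} refl)

  startsWith-shape : ∀ {u v} w → T (startsWithEdge G u v w) → ∃ λ r → w ≡ u ∷ v ∷ r
  startsWith-shape (a ∷ b ∷ r) starts
    with a≡u , b≡v ← to T-∧ starts
    with refl ← toWitness {a? = a ≟ _} a≡u
    with refl ← toWitness {a? = b ≟ _} b≡v = r , refl

  signature-↭ : ∀ g x → map (ε G g x) (neighbours G x) ↭ signature G g x
  signature-↭ g x = ↭-sym (SortingAlgorithm.sort-↭ mergeSort (map (ε G g x) (neighbours G x)))

  signature-entry : ∀ g x {k} → k ∈ signature G g x → ∃ λ y → y ∈ neighbours G x × k ≡ ε G g x y
  signature-entry g x k∈ = ∈-map⁻ (ε G g x) (∈-resp-↭ (↭-sym (signature-↭ g x)) k∈)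

  module _ (g : ℕ) where

    GirthCycle : List V → Set
    GirthCycle w = IsCycle w × length w ≡ g

    GirthCycle-rotate : ∀ s r → GirthCycle (s ++ r) → GirthCycle (r ++ s)
    GirthCycle-rotate s r (cyc , len) = IsCycle-rotate s r cyc , trans (sym (length-++-comm s r)) len

    GirthCycle-reverse : ∀ {w} → GirthCycle w → GirthCycle (reverse w)
    GirthCycle-reverse {w} (cyc , len) = IsCycle-reverse cyc , trans (length-reverse w) len

    cycleFrom? : ∀ u v w → Dec (T (isCycle G w ∧ startsWithEdge G u v w))
    cycleFrom? u v w = T? (isCycle G w ∧ startsWithEdge G u v w)

    cyclesFrom : V → V → List (List V)
    cyclesFrom u v = filter (cycleFrom? u v) (walks G (g ∸ 1) u)

    ∈-cyclesFrom⁺ : ∀ {u v r} → GirthCycle (u ∷ v ∷ r) → (u ∷ v ∷ r) ∈ cyclesFrom u v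
    ∈-cyclesFrom⁺ {u} {v} {r} (cyc , len) =
      ∈-filter⁺ (cycleFrom? u v) listed (from T-∧ (IsCycle⇒isCycle cyc , startsWithEdge-here {u} {v} {r}))
      where
      listed : (u ∷ v ∷ r) ∈ walks G (g ∸ 1) u
      listed = subst (λ k → (u ∷ v ∷ r) ∈ walks G k u) (cong (_∸ 1) len)
                 (walk-listed (v ∷ r) (Linked-prefix (u ∷ v ∷ r) (closedWalk cyc)))

    ∈-cyclesFrom⁻ : ∀ {u v w} → w ∈ cyclesFrom u v → ∃ λ r → w ≡ u ∷ v ∷ r × GirthCycle w
    ∈-cyclesFrom⁻ {u} {v} {w} w∈
      with listed , ok ← ∈-filter⁻ (cycleFrom? u v) {xs = walks G (g ∸ 1) u} w∈
      with cyc , starts ← to T-∧ ok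
      with r , refl ← startsWith-shape {u} {v} w starts
      with ws , refl , len ← walk-shape (g ∸ 1) listed =
      r , refl , cyc′ , trans (cong suc len) (length-girth g (subst (3 ≤_) (cong suc len) (atLeast3 cyc′)))
      where
      cyc′ : IsCycle w
      cyc′ = isCycle⇒IsCycle w cyc

    Active : V → V → Set
    Active x y = 0 < ε G g x y

    active-at-start : ∀ {x y r} → GirthCycle (x ∷ y ∷ r) → Active x y
    active-at-start c = ∈⇒0<length (∈-cyclesFrom⁺ c)

    consecutive-active : ∀ s {x y} t → GirthCycle (s ++ x ∷ y ∷ t) → Active x y
    consecutive-active s t c = active-at-start (GirthCycle-rotate s (_ ∷ _ ∷ t) c)

    consecutive-active-backward : ∀ s {y x} t → GirthCycle (s ++ y ∷ x ∷ t) → Active x y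
    consecutive-active-backward s {y} {x} t c =
      consecutive-active (reverse t) (reverse s) (subst GirthCycle (reverse-around s y x t) (GirthCycle-reverse c))

    Active⇒neighbour : ∀ {x y} → Active x y → y ∈ neighbours G x
    Active⇒neighbour act
      with w , w∈ ← 0<length⇒∈ act
      with r , refl , (cyc , _) ← ∈-cyclesFrom⁻ w∈
      with a ∷ _ ← closedWalk cyc = Adj⇒neighbour a

    Turn : V → V → V → Set
    Turn a x y = Active x a × Active x y × a ≢ y

    girthCycle-turn : ∀ s {a x y} t → GirthCycle (s ++ a ∷ x ∷ y ∷ t) → Turn a x y
    girthCycle-turn s {a} {x} {y} t c =
      consecutive-active-backward s (y ∷ t) c , consecutive-active (s ++ [ a ]) t shifted , a≢y
      where
      shifted : GirthCycle ((s ++ [ a ]) ++ x ∷ y ∷ t)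
      shifted = subst GirthCycle (sym (++-assoc s [ a ] (x ∷ y ∷ t))) c

      a≢y : a ≢ y
      a≢y with (_ ∷ a≢y ∷ _) ∷ _ ← noRepeat (proj₁ (GirthCycle-rotate s (a ∷ x ∷ y ∷ t) c)) = a≢y

    ActiveTrail : List V → Set
    ActiveTrail (a ∷ x ∷ y ∷ t) = Turn a x y × ActiveTrail (x ∷ y ∷ t)
    ActiveTrail _               = ⊤

    girthCycle⇒ActiveTrail : ∀ s w → GirthCycle (s ++ w) → ActiveTrail w
    girthCycle⇒ActiveTrail s (a ∷ x ∷ y ∷ t) c =
      girthCycle-turn s t c ,
      girthCycle⇒ActiveTrail (s ++ [ a ]) (x ∷ y ∷ t) (subst GirthCycle (sym (++-assoc s [ a ] _)) c)
    girthCycle⇒ActiveTrail s []              _ = tt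
    girthCycle⇒ActiveTrail s (_ ∷ [])        _ = tt
    girthCycle⇒ActiveTrail s (_ ∷ _ ∷ [])    _ = tt

    AtMostTwoActive : V → Set
    AtMostTwoActive x = ∀ {a y d} → Active x a → Active x y → Active x d → a ≢ y → d ≢ a → d ≡ y

    zero-edge⇒AtMostTwoActive : ∀ {x z} → degree G x ≡ 3 → z ∈ neighbours G x → ε G g x z ≡ 0 →
                                AtMostTwoActive x
    zero-edge⇒AtMostTwoActive {x} {z} deg z∈ εxz≡0 {a} {y} {d} xa xy xd a≢y d≢a with d ≟ y
    ... | yes d≡y = d≡y
    ... | no d≢y  = ⊥-elim (four≰three (subst (4 ≤_) deg (unique⊆⇒length≤ pairwiseDistinct members)))
      where
      z≢ : ∀ {v} → Active x v → z ≢ v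
      z≢ xv refl = <-irrefl refl (subst (0 <_) εxz≡0 xv)

      pairwiseDistinct : Unique (z ∷ a ∷ y ∷ d ∷ [])
      pairwiseDistinct =
        (z≢ xa ∷ z≢ xy ∷ z≢ xd ∷ []) ∷ (a≢y ∷ (d≢a ∘ sym) ∷ []) ∷ ((d≢y ∘ sym) ∷ []) ∷ [] ∷ []

      members : All (_∈ neighbours G x) (z ∷ a ∷ y ∷ d ∷ [])
      members = z∈ ∷ Active⇒neighbour xa ∷ Active⇒neighbour xy ∷ Active⇒neighbour xd ∷ []

      four≰three : ¬ 4 ≤ 3
      four≰three (s≤s (s≤s (s≤s ())))

    trail-determined : (∀ x → AtMostTwoActive x) → ∀ {p q} r₁ r₂ →
                       ActiveTrail (p ∷ q ∷ r₁) → ActiveTrail (p ∷ q ∷ r₂) →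
                       length r₁ ≡ length r₂ → r₁ ≡ r₂
    trail-determined two []       []       _ _ _ = refl
    trail-determined two (s ∷ r₁) (t ∷ r₂) ((qp , qs , p≢s) , trail₁) ((_ , qt , p≢t) , trail₂) len
      with refl ← two _ qp qs qt p≢s (p≢t ∘ sym) =
      cong (s ∷_) (trail-determined two r₁ r₂ trail₁ trail₂ (suc-injective len))

    ε≤1 : (∀ x → AtMostTwoActive x) → ∀ u v → ε G g u v ≤ 1
    ε≤1 two u v = allEqual⇒length≤1 (filter⁺ (cycleFrom? u v) (walks-unique (g ∸ 1) u)) same
      where
      same : ∀ {w w′} → w ∈ cyclesFrom u v → w′ ∈ cyclesFrom u v → w ≡ w′
      same w∈ w′∈
        with r , refl , c ← ∈-cyclesFrom⁻ w∈
        with r′ , refl , c′ ← ∈-cyclesFrom⁻ w′∈ =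
        cong (λ r → u ∷ v ∷ r)
          (trail-determined two r r′ (girthCycle⇒ActiveTrail [] _ c) (girthCycle⇒ActiveTrail [] _ c′)
            (suc-injective (suc-injective (trans (proj₂ c) (sym (proj₂ c′))))))

    ones-at-girthCycle : (∀ x → AtMostTwoActive x) → ∀ {x₀ x₁ x₂ r} →
                         GirthCycle (x₀ ∷ x₁ ∷ x₂ ∷ r) → 2 ≤ ones (signature G g x₁)
    ones-at-girthCycle two {x₀} {x₁} {x₂} c
      with (x₁x₀ , x₁x₂ , x₀≢x₂) , _ ← girthCycle⇒ActiveTrail [] _ c =
      begin
        2                                  ≤⟨ unique⊆⇒length≤ endsDistinct (one x₁x₀ ∷ one x₁x₂ ∷ []) ⟩
        length (filter isOne N)            ≡⟨ length-filter-map (_≟ℕ 1) ε₁ N ⟨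
        ones (map ε₁ N)                    ≡⟨ ↭-length (filter-↭ (_≟ℕ 1) (signature-↭ g x₁)) ⟩
        ones (signature G g x₁)            ∎
      where
      open ≤-Reasoning
      endsDistinct : Unique (x₀ ∷ x₂ ∷ [])
      endsDistinct = (x₀≢x₂ ∷ []) ∷ [] ∷ []

      N : List V
      N = neighbours G x₁

      ε₁ : V → ℕ
      ε₁ = ε G g x₁

      isOne : ∀ y → Dec (ε₁ y ≡ 1)
      isOne y = ε₁ y ≟ℕ 1

      one : ∀ {y} → Active x₁ y → y ∈ filter isOne N
      one act = ∈-filter⁺ isOne (Active⇒neighbour act) (≤-antisym (ε≤1 two _ _) act)

lemma3p2 : ∀ {n : ℕ} (G : Graph n) (g b c : ℕ) → Cubic G → Girth G g →
    GirthRegular G g → (∀ (v : Fin n) → signature G g v ≡ 0 ∷ b ∷ c ∷ []) →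
    b ≡ 1 × c ≡ 1
lemma3p2 G g b c cubic ((x₀ ∷ x₁ ∷ x₂ ∷ r , len , cyc) , _) _ sig =
  two-ones⇒ b c (subst (λ σ → 2 ≤ ones σ) (sig x₁)
    (ones-at-girthCycle G g atMostTwoActive (isCycle⇒IsCycle G (x₀ ∷ x₁ ∷ x₂ ∷ r) cyc , len)))
  where
  -- Every vertex has an edge with ε = 0, the first entry of its signature.
  atMostTwoActive : ∀ x → AtMostTwoActive G g x
  atMostTwoActive x with z , z∈ , 0≡εxz ← signature-entry G g x (subst (0 ∈_) (sym (sig x)) (here refl)) =
    zero-edge⇒AtMostTwoActive G g (cubic x) z∈ (sym 0≡εxz)
-- A girth cycle has at least three vertices.
lemma3p2 G g b c _ (([]              , _ , ()) , _) _ _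
lemma3p2 G g b c _ (((_ ∷ [])        , _ , ()) , _) _ _
lemma3p2 G g b c _ (((_ ∷ _ ∷ [])    , _ , ()) , _) _ _
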